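{- Let $T$ be a labeled tree on $[n]$ and $\pi\in\mathfrak{S}_n$. Then $T$ is a spanning tree of $G_\pi$ if and only if $(T,\pi^{ -1})$ is a tiered tree.
   Context: $G_\pi$ is the permutation graph: vertex set $[n]$, and for positions $i<j$ with $\pi_i>\pi_j$ there is an edge $\{\pi_i,\pi_j\}$. A tiered tree is a pair $(T,t)$ with $T$ a labeled tree on $[n]$ and $t:[n]\to[k]$ surjective such that for every edge $\{i,j\}$ of $T$ with $i>j$, $t(i)<t(j)$. -}

module Defs where

open import Data.Nat using (ℕ; zero; suc)
open import Data.Fin using (Fin; zero; suc; _<_; _>_; inject₁; fromℕ)
open import Data.Fin.Properties using (<-irrefl)
open import Data.Fin.Permutation using (Permutation′; _⟨$⟩ʳ_; _⟨$⟩ˡ_)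
open import Data.Product using (Σ; ∃; ∃-syntax; _×_; _,_)
open import Data.Sum using (_⊎_; inj₁; inj₂)
open import Data.Empty using (⊥)
open import Function.Definitions using (Injective; Surjective)
open import Relation.Binary.PropositionalEquality using (_≡_; refl; sym; trans; subst)
open import Relation.Nullary using (¬_)
open import Function.Bundles using (_⇔_)

record Graph (n : ℕ) : Set₁ where
  field
    Adj   : Fin n → Fin n → Set
    adj-sym : ∀ {a b} → Adj a b → Adj b a
    adj-irrefl : ∀ {a} → ¬ Adj a a
open Graph public

data Walk {n : ℕ} (G : Graph n) : Fin n → Fin n → Set where
  here : ∀ {u} → Walk G u u
  step : ∀ {u v w} → Adj G u v → Walk G v w → Walk G u w

Connected : {n : ℕ} → Graph n → Set
Connected G = ∀ u v → Walk G u v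

-- A cycle: k+3 pairwise distinct vertices v₀,…,v_{k+2}, consecutive ones
-- adjacent, and v_{k+2} adjacent to v₀.
Cycle : {n : ℕ} → Graph n → Set
Cycle {n} G =
  Σ ℕ λ k → Σ (Fin (suc (suc (suc k))) → Fin n) λ v →
    Injective _≡_ _≡_ v
    × (∀ (i : Fin (suc (suc k))) → Adj G (v (inject₁ i)) (v (suc i)))
    × Adj G (v (fromℕ (suc (suc k)))) (v zero)

Acyclic : {n : ℕ} → Graph n → Set
Acyclic G = ¬ Cycle G

IsTree : {n : ℕ} → Graph n → Set
IsTree G = Connected G × Acyclic G

IsSpanningTreeOf : {n : ℕ} → Graph n → Graph n → Set
IsSpanningTreeOf T G = IsTree T × (∀ a b → Adj T a b → Adj G a b)

permAdj : {n : ℕ} → Permutation′ n → Fin n → Fin n → Set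
permAdj π a b = ∃[ i ] ∃[ j ] (i < j × (π ⟨$⟩ʳ i) > (π ⟨$⟩ʳ j)
  × ((a ≡ π ⟨$⟩ʳ i × b ≡ π ⟨$⟩ʳ j) ⊎ (a ≡ π ⟨$⟩ʳ j × b ≡ π ⟨$⟩ʳ i)))

private
  permAdj-sym : {n : ℕ} (π : Permutation′ n) {a b : Fin n} → permAdj π a b → permAdj π b a
  permAdj-sym π (i , j , p , q , inj₁ (x , y)) = i , j , p , q , inj₂ (y , x)
  permAdj-sym π (i , j , p , q , inj₂ (x , y)) = i , j , p , q , inj₁ (y , x)

  permAdj-irrefl : {n : ℕ} (π : Permutation′ n) {a : Fin n} → ¬ permAdj π a a
  permAdj-irrefl π (i , j , p , q , inj₁ (x , y)) = <-irrefl (trans (sym y) x) q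
  permAdj-irrefl π (i , j , p , q , inj₂ (x , y)) = <-irrefl (trans (sym x) y) q

permGraph : {n : ℕ} → Permutation′ n → Graph n
permGraph π = record { Adj = permAdj π ; adj-sym = permAdj-sym π ; adj-irrefl = permAdj-irrefl π }

IsTieredTree : {n k : ℕ} → Graph n → (Fin n → Fin k) → Set
IsTieredTree T t = IsTree T × Surjective _≡_ _≡_ t
  × (∀ i j → Adj T i j → j < i → t i < t j)

-- An edge {a, b} with b < a lies in G_π exactly when π lists a before b,
-- i.e. when π⁻¹(a) < π⁻¹(b); this is the tiering condition for t = π⁻¹,
-- and t = π⁻¹ is a bijection, hence surjective.
module Submission where

open import Defs
open import Data.Nat using (ℕ)
open import Data.Fin using (_<_)
open import Data.Fin.Properties using (<-cmp; <-asym)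
open import Data.Fin.Permutation using (Permutation′; _⟨$⟩ˡ_; _⟨$⟩ʳ_; inverseˡ; inverseʳ; flip)
open import Function.Bundles using (_⇔_; mk⇔; Surjection; Equivalence)
open import Function.Properties.Inverse using (↔⇒↠)
open import Function.Definitions using (Surjective)
open import Data.Product using (_,_)
open import Data.Sum using (inj₁; inj₂)
open import Data.Empty using (⊥-elim)
open import Relation.Binary using (tri<; tri≈; tri>)
open import Relation.Binary.PropositionalEquality using (_≡_; refl; sym; subst₂)

adj-from-descending : {n : ℕ} (G H : Graph n) →
  (∀ a b → Adj G a b → b < a → Adj H a b) → ∀ a b → Adj G a b → Adj H a b
adj-from-descending G H desc a b e with <-cmp a b
... | tri< a<b _ _ = adj-sym H (desc b a (adj-sym G e) a<b)
... | tri≈ _ refl _ = ⊥-elim (adj-irrefl G e)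
... | tri> _ _ b<a = desc a b e b<a

module _ {n : ℕ} (π : Permutation′ n) where

  ⟨$⟩ˡ-surjective : Surjective _≡_ _≡_ (π ⟨$⟩ˡ_)
  ⟨$⟩ˡ-surjective = Surjection.surjective (↔⇒↠ (flip π))

  permAdj⇔⟨$⟩ˡ-inversion : ∀ {a b} → b < a → permAdj π a b ⇔ π ⟨$⟩ˡ a < π ⟨$⟩ˡ b
  permAdj⇔⟨$⟩ˡ-inversion {a} {b} b<a = mk⇔ inversion adjacent
    where
    inversion : permAdj π a b → π ⟨$⟩ˡ a < π ⟨$⟩ˡ b
    inversion (_ , _ , i<j , _   , inj₁ (refl , refl)) = subst₂ _<_ (sym (inverseˡ π)) (sym (inverseˡ π)) i<j
    inversion (_ , _ , _   , πj<πi , inj₂ (refl , refl)) = ⊥-elim (<-asym b<a πj<πi)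

    adjacent : π ⟨$⟩ˡ a < π ⟨$⟩ˡ b → permAdj π a b
    adjacent πa<πb = π ⟨$⟩ˡ a , π ⟨$⟩ˡ b , πa<πb
                   , subst₂ _<_ (sym (inverseʳ π)) (sym (inverseʳ π)) b<a
                   , inj₁ (sym (inverseʳ π) , sym (inverseʳ π))

proposition2p5 : (n : ℕ) (T : Graph n) (π : Permutation′ n) → IsTree T →
    (IsSpanningTreeOf T (permGraph π) ⇔ IsTieredTree T (π ⟨$⟩ˡ_))
proposition2p5 n T π tree = mk⇔ tiered spanning
  where
  tiered : IsSpanningTreeOf T (permGraph π) → IsTieredTree T (π ⟨$⟩ˡ_)
  tiered (_ , inG) = tree , ⟨$⟩ˡ-surjective π
    , λ a b e b<a → Equivalence.to (permAdj⇔⟨$⟩ˡ-inversion π b<a) (inG a b e)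

  spanning : IsTieredTree T (π ⟨$⟩ˡ_) → IsSpanningTreeOf T (permGraph π)
  spanning (_ , _ , tier) = tree , adj-from-descending T (permGraph π)
    λ a b e b<a → Equivalence.from (permAdj⇔⟨$⟩ˡ-inversion π b<a) (tier a b e b<a)
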